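{- Let $A,A'$ be automata, $L,R,J\subseteq(Ctrl\times Ctrl')\times(Sto\times Sto')$, and $\mathcal{Q},\mathcal{S}\subseteq Sto\times Sto'$. Suppose $\prod(A,A',L,R,J)$ is $\mathcal{Q}$-adequate and $an$ is an annotation of $\prod(A,A',L,R,J)$ for $\{\mathcal{Q}\}\{\mathcal{S}\}$. If $an$ is valid then $A,A'\models\langle\mathcal{Q}\rangle\langle\mathcal{S}\rangle$.
   Context: An automaton is $(Ctrl,Sto,init,fin,\Rightarrow)$ with $Sto$ a set, $Ctrl$ a finite set containing distinct $init,fin$, and ${\Rightarrow}\subseteq(Ctrl\times Sto)^2$ with $(n,s)\Rightarrow(m,t)$ implying $n\ne fin$ and $n\ne m$. For $A=(Ctrl,Sto,init,fin,\Rightarrow)$ and $A'=(Ctrl',Sto',init',fin',\Rightarrow')$, $\prod(A,A',L,R,J)$ has control points $Ctrl\times Ctrl'$, stores $Sto\times Sto'$, initial point $(init,init')$, final point $(fin,fin')$, and $((n,n'),(s,s'))\Rightarrow((m,m'),(t,t'))$ iff: ($\in L$, $(n,s)\Rightarrow(m,t)$, $(n',s')=(m',t')$) or ($\in R$, $(n,s)=(m,t)$, $(n',s')\Rightarrow'(m',t')$) or ($\in J$, $(n,s)\Rightarrow(m,t)$, $(n',s')\Rightarrow'(m',t')$). It is $\mathcal{Q}$-adequate if for all $(s,s')\in\mathcal{Q}$ and $t,t'$ with $(init,s)\Rightarrow^*(fin,t)$, $(init',s')\Rightarrow'^*(fin',t')$, we have $((init,init'),(s,s'))\Rightarrow^*((fin,fin'),(t,t'))$.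 An annotation of an automaton $B$ for $\{P\}\{Q\}$ is a map $an$ from control points of $B$ to subsets of its stores with $an(init_B)=P$ and $an(fin_B)=Q$; it is valid if for all control points $n,m$, $s\in an(n)$ and $(n,s)\Rightarrow(m,t)$ imply $t\in an(m)$. $A,A'\models\langle\mathcal{Q}\rangle\langle\mathcal{S}\rangle$ means: whenever $(init,s)\Rightarrow^*(fin,t)$, $(init',s')\Rightarrow'^*(fin',t')$ and $(s,s')\in\mathcal{Q}$, then $(t,t')\in\mathcal{S}$. -}

module Defs where

open import Level using (0ℓ)
open import Data.Nat using (ℕ)
open import Data.Fin using (Fin)
open import Data.Product using (Σ; _×_; _,_)
open import Data.Sum using (_⊎_)
open import Relation.Nullary using (¬_)
open import Relation.Binary.PropositionalEquality using (_≡_)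
open import Relation.Binary.Construct.Closure.ReflexiveTransitive using (Star)
open import Function.Bundles using (_↔_)

Pred₀ : Set → Set₁
Pred₀ X = X → Set

record Automaton : Set₁ where
  field
    Ctrl      : Set
    Sto       : Set
    ctrlSize  : ℕ
    ctrlFin   : Ctrl ↔ Fin ctrlSize
    init      : Ctrl
    fin       : Ctrl
    init≢fin  : ¬ (init ≡ fin)
    _⇒_       : Ctrl × Sto → Ctrl × Sto → Set
    ⇒-notFin  : ∀ {n s m t} → (n , s) ⇒ (m , t) → ¬ (n ≡ fin)
    ⇒-move    : ∀ {n s m t} → (n , s) ⇒ (m , t) → ¬ (n ≡ m)

  _⇒*_ : Ctrl × Sto → Ctrl × Sto → Set
  _⇒*_ = Star _⇒_

open Automaton public

module _ (A A' : Automaton) where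
  private
    module A  = Automaton A
    module A' = Automaton A'

  PCtrl : Set
  PCtrl = A.Ctrl × A'.Ctrl

  PSto : Set
  PSto = A.Sto × A'.Sto

  ProdStep : (L R J : Pred₀ (PCtrl × PSto)) → PCtrl × PSto → PCtrl × PSto → Set
  ProdStep L R J ((n , n') , (s , s')) ((m , m') , (t , t')) =
      (L ((n , n') , (s , s')) × A._⇒_ (n , s) (m , t) × ((n' , s') ≡ (m' , t')))
    ⊎ (R ((n , n') , (s , s')) × ((n , s) ≡ (m , t)) × A'._⇒_ (n' , s') (m' , t'))
    ⊎ (J ((n , n') , (s , s')) × A._⇒_ (n , s) (m , t) × A'._⇒_ (n' , s') (m' , t'))

  ProdStep* : (L R J : Pred₀ (PCtrl × PSto)) → PCtrl × PSto → PCtrl × PSto → Set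
  ProdStep* L R J = Star (ProdStep L R J)

  pinit pfin : PCtrl
  pinit = A.init , A'.init
  pfin  = A.fin , A'.fin

  Adequate : (L R J : Pred₀ (PCtrl × PSto)) → Pred₀ PSto → Set
  Adequate L R J Q =
    ∀ s s' t t' → Q (s , s') →
    A._⇒*_ (A.init , s) (A.fin , t) →
    A'._⇒*_ (A'.init , s') (A'.fin , t') →
    ProdStep* L R J (pinit , (s , s')) (pfin , (t , t'))

  IsAnnotation : (an : PCtrl → Pred₀ PSto) (P Q : Pred₀ PSto) → Set₁
  IsAnnotation an P Q = (an pinit ≡ P) × (an pfin ≡ Q)

  Valid : (L R J : Pred₀ (PCtrl × PSto)) → (PCtrl → Pred₀ PSto) → Set
  Valid L R J an =
    ∀ n m s t → an n s → ProdStep L R J (n , s) (m , t) → an m t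

  RelSat : Pred₀ PSto → Pred₀ PSto → Set
  RelSat Q S =
    ∀ s s' t t' →
    A._⇒*_ (A.init , s) (A.fin , t) →
    A'._⇒*_ (A'.init , s') (A'.fin , t') →
    Q (s , s') → S (t , t')

{-# OPTIONS --safe #-}
module Submission where

open import Defs
open import Data.Product using (_×_; _,_; uncurry)
open import Relation.Binary.Core using (Rel)
open import Relation.Binary.Definitions using (_Respects_)
open import Relation.Binary.PropositionalEquality using (refl)
open import Relation.Binary.Construct.Closure.ReflexiveTransitive using (Star; ε; _◅_)

-- A valid annotation is an invariant of the product automaton. Adequacy merges two terminating
-- runs of A and A' from Q-related stores into one run of the product from (init, init') to
-- (fin, fin'), along which the invariant carries an (init, init') = Q to an (fin, fin') = S.

star-respects : ∀ {a p r} {X : Set a} {P : X → Set p} {T : Rel X r} →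
                P Respects T → P Respects Star T
star-respects resp ε        p = p
star-respects resp (t ◅ ts) p = star-respects resp ts (resp t p)

valid⇒respects-ProdStep : (A A' : Automaton) (L R J : Pred₀ (PCtrl A A' × PSto A A'))
                          (an : PCtrl A A' → Pred₀ (PSto A A')) →
                          Valid A A' L R J an →
                          uncurry an Respects ProdStep A A' L R J
valid⇒respects-ProdStep A A' L R J an valid {n , s} {m , t} step annotated = valid n m s t annotated step

corollary3p13 : (A A' : Automaton)
                (L R J : Pred₀ (PCtrl A A' × PSto A A'))
                (Q S : Pred₀ (PSto A A'))
                (an : PCtrl A A' → Pred₀ (PSto A A')) →
                Adequate A A' L R J Q →
                IsAnnotation A A' an Q S →
                Valid A A' L R J an →
                RelSat A A' Q S
corollary3p13 A A' L R J Q S an adequate (refl , refl) valid s s' t t' run run' q =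
  star-respects (valid⇒respects-ProdStep A A' L R J an valid)
                (adequate s s' t t' q run run') q
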